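{- Let $R$ be a $\mathbb{U}_{\mathrm{opt}}$-LL 3-eDCTRS over a signature $\mathcal{F}$ which is non-LV or non-RV. Let $s\in T(\mathcal{F},\mathcal{V})$, let $t\in T(\mathcal{F},\mathcal{V})$ be linear, and let $\sigma$ be a substitution with range in $T(\mathcal{F}_{\mathbb{U}_{\mathrm{opt}}(R)},\mathcal{V})$. If $s\rightrightarrows^n_{\mathbb{U}_{\mathrm{opt}}(R)}t\sigma$ for some $n\ge0$, then there exists a substitution $\theta$ with range in $T(\mathcal{F},\mathcal{V})$ such that $s\to^*_R t\theta\rightrightarrows^{n'}_{\ge\mathrm{Pos}_{\mathcal{V}}(t),\mathbb{U}_{\mathrm{opt}}(R)}t\sigma$ for some $n'\le n$, and such that $t\theta=t\sigma$ whenever $t\sigma\in T(\mathcal{F},\mathcal{V})$.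
   Context: Terms $T(\mathcal{F},\mathcal{V})$, $\mathrm{Var}(\cdot)$ variables occurring, $\mathrm{Pos}_{\mathcal{V}}(t)$ the set of variable positions of $t$, $p\le q$ the prefix order on positions. Linear term: no variable occurs twice. An extended conditional rule is $\rho:l\to r\Leftarrow s_1\twoheadrightarrow t_1;\dots;s_k\twoheadrightarrow t_k$ ($l$ may be a variable); eCTRS = set of such rules, with rewrite relation $\to_R=\bigcup_n\to_{(n),R}$, $\to_{(0),R}=\emptyset$, $\to_{(i+1),R}=\{(C[l\sigma],C[r\sigma])\mid s_j\sigma\to^*_{(i),R}t_j\sigma\ \forall j\}$. Deterministic rule: $\mathrm{Var}(s_i)\subseteq\mathrm{Var}(l,t_1,\dots,t_{i-1})$; Type 3: $\mathrm{Var}(r)\subseteq\mathrm{Var}(l,s_1,t_1,\dots,s_k,t_k)$; a 3-eDCTRS has all rules deterministic and of Type 3. Rule properties: LL ($l$ linear), non-LV ($l\notin\mathcal{V}$), non-RV ($r\notin\mathcal{V}$); an eCTRS has a property if all rules do. Optimized unraveling: for $k\ge1$, $X_i=\mathrm{Var}(l,t_1,\dots,t_{i-1})$, $Y_i=\mathrm{Var}(r,t_i,s_{i+1},t_{i+1},\dots,s_k,t_k)$, $Z_i=X_i\cap Y_i$, $\overrightarrow{X}$ a fixed listing of a finite set $X$, fresh $U^\rho_1,\dots,U^\rho_k$; $\mathbb{U}_{\mathrm{opt}}(\rho)=\{l\to U^\rho_1(s_1,\overrightarrow{Z_1})\}\cup\{U^\rho_i(t_i,\overrightarrow{Z_i})\to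 U^\rho_{i+1}(s_{i+1},\overrightarrow{Z_{i+1}})\mid1\le i<k\}\cup\{U^\rho_k(t_k,\overrightarrow{Z_k})\to r\}$, unconditional rules kept; $\mathbb{U}_{\mathrm{opt}}(R)$ is the union, an eTRS over $\mathcal{F}_{\mathbb{U}_{\mathrm{opt}}(R)}=\mathcal{F}\cup\{U^\rho_i\}$. $\rho$ is $\mathbb{U}_{\mathrm{opt}}$-LL if every rule in $\mathbb{U}_{\mathrm{opt}}(\rho)$ has a linear left-hand side. Parallel reduction: $u\rightrightarrows_S v$ if $u=C[u_1,\dots,u_m]_{p_1,\dots,p_m}$ and $v=C[v_1,\dots,v_m]_{p_1,\dots,p_m}$ for pairwise parallel positions $p_1,\dots,p_m$ with $u_j\to_S v_j$ for all $j$; for a set $P$ of positions, $\rightrightarrows_{\ge P,S}$ is the restriction to steps in which every $p_j$ satisfies $p\le p_j$ for some $p\in P$; $\rightrightarrows^n$ denotes $n$-fold composition. -}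

module Defs where

open import Data.Nat using (ℕ; zero; suc; _≟_)
open import Data.Fin using (Fin; toℕ)
open import Data.List using (List; []; _∷_; _++_; map; concatMap; take; drop; length; lookup; filter; deduplicate)
open import Data.List.Relation.Unary.All using (All)
open import Data.List.Relation.Unary.Any using (Any)
open import Data.List.Relation.Unary.Unique.Propositional using (Unique)
open import Data.List.Relation.Binary.Subset.Propositional using (_⊆_)
open import Data.List.Membership.DecPropositional _≟_ using (_∈?_)
open import Data.Vec using (Vec; []; _∷_; fromList)
import Data.Vec as V
open import Data.Product using (Σ; _×_; _,_; proj₁; proj₂)
open import Data.Sum using (_⊎_; inj₁; inj₂)
open import Data.Unit using (⊤)
open import Data.Empty using (⊥)
open import Relation.Binary.PropositionalEquality using (_≡_; _≢_)
open import Relation.Binary.Construct.Closure.ReflexiveTransitive using (Star)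

module Generic {S : Set} (ar : S → ℕ) where

  data Term : Set where
    var : ℕ → Term
    fun : (f : S) → Vec Term (ar f) → Term

  -- positions: sequences of (0-based) argument indices
  Pos : Set
  Pos = List ℕ

  _≼_ : Pos → Pos → Set
  p ≼ q = Σ Pos λ r → p ++ r ≡ q

  mutual
    -- variable occurrences (with repetitions, left to right)
    vars : Term → List ℕ
    vars (var x) = x ∷ []
    vars (fun f ts) = varsV ts

    varsV : ∀ {n} → Vec Term n → List ℕ
    varsV [] = []
    varsV (t ∷ ts) = vars t ++ varsV ts

  Linear : Term → Set
  Linear t = Unique (vars t)

  NonVar : Term → Set
  NonVar t = ∀ x → t ≢ var x

  mutual
    sub : (ℕ → Term) → Term → Term
    sub σ (var x) = σ x
    sub σ (fun f ts) = fun f (subV σ ts)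

    subV : ∀ {n} → (ℕ → Term) → Vec Term n → Vec Term n
    subV σ [] = []
    subV σ (t ∷ ts) = sub σ t ∷ subV σ ts

  mutual
    varPos : Term → List Pos
    varPos (var x) = [] ∷ []
    varPos (fun f ts) = varPosV 0 ts

    varPosV : ∀ {n} → ℕ → Vec Term n → List Pos
    varPosV i [] = []
    varPosV i (t ∷ ts) = map (i ∷_) (varPos t) ++ varPosV (suc i) ts

  mutual
    AllSyms : (S → Set) → Term → Set
    AllSyms P (var x) = ⊤
    AllSyms P (fun f ts) = P f × AllSymsV P ts

    AllSymsV : ∀ {n} → (S → Set) → Vec Term n → Set
    AllSymsV P [] = ⊤
    AllSymsV P (t ∷ ts) = AllSyms P t × AllSymsV P ts

  Rel : Set₁
  Rel = Term → Term → Set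

  mutual
    data Ctx (Root : Rel) : Rel where
      root : ∀ {u v} → Root u v → Ctx Root u v
      cong : ∀ {f us vs} → CtxV Root us vs → Ctx Root (fun f us) (fun f vs)

    data CtxV (Root : Rel) : ∀ {n} → Vec Term n → Vec Term n → Set where
      here  : ∀ {n u v} {us : Vec Term n} → Ctx Root u v → CtxV Root (u ∷ us) (v ∷ us)
      there : ∀ {n u} {us vs : Vec Term n} → CtxV Root us vs → CtxV Root (u ∷ us) (u ∷ vs)

  -- a (possibly extended) TRS is a set of rules l → r, given as a relation
  RootStep : Rel → Rel
  RootStep Sr u v = Σ Term λ l → Σ Term λ r → Sr l r ×
                    Σ (ℕ → Term) λ σ → (u ≡ sub σ l) × (v ≡ sub σ r)

  Step : Rel → Rel
  Step Sr = Ctx (RootStep Sr)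

  -- ParAt Sr Qs u v : u = C[u_1..u_m]_{Qs}, v = C[v_1..v_m]_{Qs}, with
  -- Qs the (pairwise parallel) positions and u_j →_S v_j
  mutual
    data ParAt (Sr : Rel) : List Pos → Term → Term → Set where
      none : ∀ {u} → ParAt Sr [] u u
      step : ∀ {u v} → Step Sr u v → ParAt Sr ([] ∷ []) u v
      args : ∀ {f us vs Qs} → ParAtV Sr 0 Qs us vs → ParAt Sr Qs (fun f us) (fun f vs)

    data ParAtV (Sr : Rel) : ∀ {n} → ℕ → List Pos → Vec Term n → Vec Term n → Set where
      []  : ∀ {i} → ParAtV Sr i [] [] []
      _∷_ : ∀ {n i Q Qs u v} {us vs : Vec Term n} →
            ParAt Sr Q u v → ParAtV Sr (suc i) Qs us vs →
            ParAtV Sr i (map (i ∷_) Q ++ Qs) (u ∷ us) (v ∷ vs)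

  Par : Rel → Rel
  Par Sr u v = Σ (List Pos) λ Qs → ParAt Sr Qs u v

  ParGe : List Pos → Rel → Rel
  ParGe P Sr u v = Σ (List Pos) λ Qs → ParAt Sr Qs u v ×
                   All (λ q → Any (λ p → p ≼ q) P) Qs

  Iter : ℕ → Rel → Rel
  Iter zero Rl u w = u ≡ w
  Iter (suc n) Rl u w = Σ Term λ v → Rl u v × Iter n Rl v w

module Sig {F : Set} (ar : F → ℕ) where

  module G = Generic ar

  TermF : Set
  TermF = G.Term

  -- extended conditional rule  l → r ⇐ s₁ ↠ t₁; …; s_k ↠ t_k
  record Rule : Set where
    constructor mkRule
    field
      lhs   : TermF
      rhs   : TermF
      conds : List (TermF × TermF)
  open Rule public

  varsC : TermF × TermF → List ℕ
  varsC c = G.vars (proj₁ c) ++ G.vars (proj₂ c)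

  -- Deterministic: Var(s_i) ⊆ Var(l, t_1, …, t_{i-1})
  Det : List ℕ → List (TermF × TermF) → Set
  Det X [] = ⊤
  Det X (c ∷ cs) = (G.vars (proj₁ c) ⊆ X) × Det (X ++ G.vars (proj₂ c)) cs

  Deterministic : Rule → Set
  Deterministic ρ = Det (G.vars (lhs ρ)) (conds ρ)

  Type3 : Rule → Set
  Type3 ρ = G.vars (rhs ρ) ⊆ (G.vars (lhs ρ) ++ concatMap varsC (conds ρ))

  NonLV : Rule → Set
  NonLV ρ = G.NonVar (lhs ρ)

  NonRV : Rule → Set
  NonRV ρ = G.NonVar (rhs ρ)

  -- conditional rewriting  →_{(n),R}  and  →_R
  CRoot : (Rule → Set) → G.Rel → G.Rel
  CRoot R Rl u v = Σ Rule λ ρ → R ρ × Σ (ℕ → TermF) λ σ →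
    (u ≡ G.sub σ (lhs ρ)) × (v ≡ G.sub σ (rhs ρ)) ×
    All (λ c → Star Rl (G.sub σ (proj₁ c)) (G.sub σ (proj₂ c))) (conds ρ)

  CStep : (Rule → Set) → ℕ → G.Rel
  CStep R zero = λ _ _ → ⊥
  CStep R (suc n) = G.Ctx (CRoot R (CStep R n))

  CArrow : (Rule → Set) → G.Rel
  CArrow R u v = Σ ℕ λ n → CStep R n u v

  -- the (0-based) i-th condition
  cond : (ρ : Rule) → Fin (length (conds ρ)) → TermF × TermF
  cond ρ i = lookup (conds ρ) i

  -- X_i, Y_i and a fixed listing of Z_i = X_i ∩ Y_i
  Xs : (ρ : Rule) → Fin (length (conds ρ)) → List ℕ
  Xs ρ i = G.vars (lhs ρ) ++ concatMap (λ c → G.vars (proj₂ c)) (take (toℕ i) (conds ρ))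

  Ys : (ρ : Rule) → Fin (length (conds ρ)) → List ℕ
  Ys ρ i = G.vars (rhs ρ) ++ G.vars (proj₂ (cond ρ i)) ++
           concatMap varsC (drop (suc (toℕ i)) (conds ρ))

  Zs : (ρ : Rule) → Fin (length (conds ρ)) → List ℕ
  Zs ρ i = filter (λ x → x ∈? Ys ρ i) (deduplicate _≟_ (Xs ρ i))

  -- extended signature F_{U_opt}: F plus fresh U^ρ_i
  SymU : Set
  SymU = F ⊎ Σ Rule (λ ρ → Fin (length (conds ρ)))

  arU : SymU → ℕ
  arU (inj₁ f) = ar f
  arU (inj₂ (ρ , i)) = suc (length (Zs ρ i))

  module H = Generic arU

  TermU : Set
  TermU = H.Term

  -- T(F,V) ⊆ T(F_U,V)
  mutual
    ι : TermF → TermU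
    ι (G.var x) = H.var x
    ι (G.fun f ts) = H.fun (inj₁ f) (ιV ts)

    ιV : ∀ {n} → Vec TermF n → Vec TermU n
    ιV [] = []
    ιV (t ∷ ts) = ι t ∷ ιV ts

  Uterm : (ρ : Rule) → Fin (length (conds ρ)) → TermU → TermU
  Uterm ρ i u = H.fun (inj₂ (ρ , i)) (u ∷ V.map H.var (fromList (Zs ρ i)))

  -- U_opt(ρ)  (0-based condition indices)
  data URule (ρ : Rule) : TermU → TermU → Set where
    uncond : conds ρ ≡ [] → URule ρ (ι (lhs ρ)) (ι (rhs ρ))
    first  : (i : Fin (length (conds ρ))) → toℕ i ≡ 0 →
             URule ρ (ι (lhs ρ)) (Uterm ρ i (ι (proj₁ (cond ρ i))))
    middle : (i j : Fin (length (conds ρ))) → toℕ j ≡ suc (toℕ i) →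
             URule ρ (Uterm ρ i (ι (proj₂ (cond ρ i)))) (Uterm ρ j (ι (proj₁ (cond ρ j))))
    final  : (i : Fin (length (conds ρ))) → suc (toℕ i) ≡ length (conds ρ) →
             URule ρ (Uterm ρ i (ι (proj₂ (cond ρ i)))) (ι (rhs ρ))

  Uopt : (Rule → Set) → H.Rel
  Uopt R l r = Σ Rule λ ρ → R ρ × URule ρ l r

  UoptLL : Rule → Set
  UoptLL ρ = ∀ l r → URule ρ l r → H.Linear l

  InSymR : (Rule → Set) → SymU → Set
  InSymR R (inj₁ f) = ⊤
  InSymR R (inj₂ (ρ , i)) = R ρ

  InTFU : (Rule → Set) → TermU → Set
  InTFU R = H.AllSyms (InSymR R)

module Submission where

-- Lemma 4.2 (lifting U_opt(R)-reductions to R) follows from a per-variable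
-- strengthening, proved by strong induction on n:
--
--   Decomposition n:  if t is linear and ι s ⇉ⁿ tσ, then s →*_R tθ for some
--   θ over F such that, for x ∈ Var(t), ι(xθ) ⇉ⁿ xσ, and ι(xθ) = xσ when xσ
--   contains no U-symbol.
--
-- For n + 1 steps, split off the last step ι s ⇉ⁿ w ⇉ tσ and analyse it by
-- induction on its derivation.  Steps inside arguments use the induction
-- hypothesis along the linear pattern f(x₀,…,x_{m-1}); unconditional rules
-- are simulated by R directly; the final rule U^ρ_k(t_k, Z_k) → r is replaced
-- by ρ itself, after recovering ρ's conditions from ι b ⇉ᵐ U^ρ_i(v, zs)
-- (module PartialApplication).  Linearity of the U_opt(ρ) left-hand sides
-- lets substitutions for disjoint parts be merged; determinism and Type 3
-- locate variables.  Finally the per-variable steps become ⇉_{≥Pos_V(t)}-steps.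

open import Defs
open import Data.Empty using (⊥; ⊥-elim)
open import Data.Fin using (Fin; toℕ) renaming (zero to fzero; suc to fsuc)
open import Data.List using (List; []; _∷_; _++_; map; concatMap; take; drop; lookup; length; deduplicate)
open import Data.Nat using (ℕ; zero; suc; _≤_; _<_; z≤n; s≤s; _≟_; _⊔_)
open import Data.List.Membership.DecPropositional _≟_ using (_∈?_)
open import Data.List.Membership.Propositional using (_∈_)
open import Data.List.Membership.Propositional.Properties using (∈-++⁺ˡ; ∈-++⁺ʳ; ∈-++⁻; ∈-filter⁺; ∈-filter⁻; ∈-deduplicate⁺; ∈-deduplicate⁻)
open import Data.List.Properties using (++-assoc; ++-identityʳ; concatMap-++; take-suc; take-all)
open import Data.List.Relation.Binary.Subset.Propositional using (_⊆_)
open import Data.List.Relation.Unary.All using (All; []; _∷_)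
import Data.List.Relation.Unary.All as All
import Data.List.Relation.Unary.All.Properties as AllP
open import Data.List.Relation.Unary.Any using (Any; here; there)
import Data.List.Relation.Unary.Any as Any
import Data.List.Relation.Unary.Any.Properties as AnyP
import Data.List.Relation.Unary.AllPairs as AllPairs
open import Data.List.Relation.Unary.Unique.Propositional using (Unique)
open import Data.Nat.Properties using (≤-refl; ≤-trans; ≤-reflexive; n≤1+n; m<n⇒m<1+n; <⇒≤; >⇒≢; m≤m⊔n; m≤n⊔m)
open import Data.Product using (Σ; _×_; _,_; proj₁; proj₂)
open import Data.Sum using (_⊎_; inj₁; inj₂)
open import Data.Vec using (Vec; []; _∷_; fromList)
import Data.Vec as V
open import Data.Vec.Relation.Binary.Pointwise.Inductive using (Pointwise; []; _∷_)
import Data.Vec.Relation.Binary.Pointwise.Inductive as PW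
open import Relation.Binary.Construct.Closure.ReflexiveTransitive using (Star; ε; _◅_; _◅◅_; gmap)
import Relation.Binary.Construct.Closure.ReflexiveTransitive as Star
open import Relation.Binary.PropositionalEquality using (_≡_; _≢_; refl; sym; trans; cong; cong₂; subst; subst₂)
open import Relation.Nullary using (¬_; yes; no)

module TermFacts {S : Set} (ar : S → ℕ) where
  open Generic ar hiding (cong)

  mutual
    sub-cong : ∀ {τ₁ τ₂} t → (∀ x → x ∈ vars t → τ₁ x ≡ τ₂ x) → sub τ₁ t ≡ sub τ₂ t
    sub-cong (var x) h = h x (here refl)
    sub-cong (fun f ts) h = cong (fun f) (subV-cong ts h)

    subV-cong : ∀ {n τ₁ τ₂} (ts : Vec Term n) → (∀ x → x ∈ varsV ts → τ₁ x ≡ τ₂ x) →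
                subV τ₁ ts ≡ subV τ₂ ts
    subV-cong [] h = refl
    subV-cong (t ∷ ts) h =
      cong₂ _∷_ (sub-cong t (λ x m → h x (∈-++⁺ˡ m))) (subV-cong ts (λ x m → h x (∈-++⁺ʳ (vars t) m)))

  iter-snoc : ∀ {Rl} n {u v w} → Iter n Rl u v → Rl v w → Iter (suc n) Rl u w
  iter-snoc zero refl r = _ , r , refl
  iter-snoc (suc n) (v , r , it) r′ = v , r , iter-snoc n it r′

  iter-unsnoc : ∀ {Rl} n {u w} → Iter (suc n) Rl u w → Σ Term λ v → Iter n Rl u v × Rl v w
  iter-unsnoc zero (v , r , refl) = _ , refl , r
  iter-unsnoc (suc n) (v , r , it) with iter-unsnoc n it
  ... | v′ , it′ , r′ = v′ , (v , r , it′) , r′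

  iter-map : ∀ {R₁ R₂ : Rel} → (∀ {u v} → R₁ u v → R₂ u v) → ∀ n {u v} → Iter n R₁ u v → Iter n R₂ u v
  iter-map f zero it = it
  iter-map f (suc n) (v , r , it) = v , f r , iter-map f n it

  iter-split-vars : ∀ {Rl} n (xs : List ℕ) {τ₁ τ₂ : ℕ → Term} →
    (∀ x → x ∈ xs → Iter (suc n) Rl (τ₁ x) (τ₂ x)) →
    Σ (ℕ → Term) λ μ → (∀ x → x ∈ xs → Rl (τ₁ x) (μ x)) × (∀ x → x ∈ xs → Iter n Rl (μ x) (τ₂ x))
  iter-split-vars {Rl} n xs {τ₁} {τ₂} h = μ , initial , remaining
    where
    μ : ℕ → Term
    μ x with x ∈? xs
    ... | yes m = proj₁ (h x m)
    ... | no _ = τ₂ x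
    initial : ∀ x → x ∈ xs → Rl (τ₁ x) (μ x)
    initial x m′ with x ∈? xs
    ... | yes m = proj₁ (proj₂ (h x m))
    ... | no m∉ = ⊥-elim (m∉ m′)
    remaining : ∀ x → x ∈ xs → Iter n Rl (μ x) (τ₂ x)
    remaining x m′ with x ∈? xs
    ... | yes m = proj₂ (proj₂ (h x m))
    ... | no m∉ = ⊥-elim (m∉ m′)

  par-refl : ∀ {Sr u} → Par Sr u u
  par-refl = [] , none

  -- Since ⇉ is reflexive, ⇉ᵐ ⊆ ⇉ⁿ for m ≤ n.
  iter-par-pad : ∀ {Sr} m n {u v} → m ≤ n → Iter m (Par Sr) u v → Iter n (Par Sr) u v
  iter-par-pad zero zero _ it = it
  iter-par-pad zero (suc n) _ it = _ , par-refl , iter-par-pad zero n z≤n it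
  iter-par-pad (suc m) (suc n) (s≤s p) (v , r , it) = v , r , iter-par-pad m n p it

  iter-par-suc : ∀ {Sr} n {u v} → Iter n (Par Sr) u v → Iter (suc n) (Par Sr) u v
  iter-par-suc n = iter-par-pad n (suc n) (n≤1+n n)

  par-args : ∀ {Sr f} {us vs : Vec Term (ar f)} → Pointwise (Par Sr) us vs → Par Sr (fun f us) (fun f vs)
  par-args ps = _ , args (proj₂ (parAtV 0 ps))
    where
    parAtV : ∀ {Sr n} i {us vs : Vec Term n} → Pointwise (Par Sr) us vs → Σ (List Pos) λ Qs → ParAtV Sr i Qs us vs
    parAtV i [] = [] , []
    parAtV i ((Q , p) ∷ ps) = _ , (p ∷ proj₂ (parAtV (suc i) ps))

  par-inversion : ∀ {Sr Qs w f} {vs : Vec Term (ar f)} → ParAt Sr Qs w (fun f vs) →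
    (Σ (Vec Term (ar f)) λ us → w ≡ fun f us × Pointwise (Par Sr) us vs) ⊎ RootStep Sr w (fun f vs)
  par-inversion none = inj₁ (_ , refl , PW.refl par-refl)
  par-inversion (step (root rs)) = inj₂ rs
  par-inversion (step (Generic.cong cv)) = inj₁ (_ , refl , ctx-args cv)
    where
    ctx-args : ∀ {Sr m} {us vs : Vec Term m} → CtxV (RootStep Sr) us vs → Pointwise (Par Sr) us vs
    ctx-args (here c) = ((([] ∷ []) , step c)) ∷ PW.refl par-refl
    ctx-args (there cv) = par-refl ∷ ctx-args cv
  par-inversion (args pv) = inj₁ (_ , refl , parAt-args pv)
    where
    parAt-args : ∀ {Sr m i Qs} {us vs : Vec Term m} → ParAtV Sr i Qs us vs → Pointwise (Par Sr) us vs
    parAt-args [] = []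
    parAt-args (p ∷ pv) = (_ , p) ∷ parAt-args pv

module Embedding {F : Set} (ar : F → ℕ) where
  open Sig ar
  open TermFacts arU

  mutual
    ι-sub : ∀ θ t → ι (G.sub θ t) ≡ H.sub (λ x → ι (θ x)) (ι t)
    ι-sub θ (G.var x) = refl
    ι-sub θ (G.fun f ts) = cong (H.fun (inj₁ f)) (ι-subV θ ts)

    ι-subV : ∀ {n} θ (ts : Vec TermF n) → ιV (G.subV θ ts) ≡ H.subV (λ x → ι (θ x)) (ιV ts)
    ι-subV θ [] = refl
    ι-subV θ (t ∷ ts) = cong₂ _∷_ (ι-sub θ t) (ι-subV θ ts)

  mutual
    vars-ι : ∀ t → H.vars (ι t) ≡ G.vars t
    vars-ι (G.var x) = refl
    vars-ι (G.fun f ts) = varsV-ι ts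

    varsV-ι : ∀ {n} (ts : Vec TermF n) → H.varsV (ιV ts) ≡ G.varsV ts
    varsV-ι [] = refl
    varsV-ι (t ∷ ts) = cong₂ _++_ (vars-ι t) (varsV-ι ts)

  linear-ι⁻ : ∀ t → H.Linear (ι t) → G.Linear t
  linear-ι⁻ t = subst Unique (vars-ι t)

  fun-injective : ∀ {f g} {xs : Vec TermU (arU g)} {ys : Vec TermU (arU f)} →
                  H.fun g xs ≡ H.fun f ys → Σ (g ≡ f) λ { refl → xs ≡ ys }
  fun-injective refl = refl , refl

  -- A pure term is one without U-symbols, i.e. in the image of ι.
  Pure : TermU → Set
  Pure w = Σ TermF λ u → ι u ≡ w

  U-impure : ∀ {p xs} u → ι u ≢ H.fun (inj₂ p) xs
  U-impure (G.var x) ()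
  U-impure (G.fun f ts) ()

  mutual
    pure-vars : ∀ {σ} t {u} → ι u ≡ H.sub σ (ι t) → ∀ x → x ∈ G.vars t → Pure (σ x)
    pure-vars (G.var y) {u} e x (here refl) = u , e
    pure-vars (G.fun f ts) {G.fun g us} e x m with fun-injective e
    ... | refl , e′ = pure-varsV ts us e′ x m

    pure-varsV : ∀ {σ n} (ts : Vec TermF n) (us : Vec TermF n) → ιV us ≡ H.subV σ (ιV ts) →
                 ∀ x → x ∈ G.varsV ts → Pure (σ x)
    pure-varsV (t ∷ ts) (u ∷ us) e x m with ∈-++⁻ (G.vars t) m
    ... | inj₁ m₁ = pure-vars t (cong V.head e) x m₁
    ... | inj₂ m₂ = pure-varsV ts us (cong V.tail e) x m₂

  ι-sub-pure : ∀ θ σ t → (∀ x → x ∈ G.vars t → Pure (σ x) → ι (θ x) ≡ σ x) →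
               Pure (H.sub σ (ι t)) → ι (G.sub θ t) ≡ H.sub σ (ι t)
  ι-sub-pure θ σ t h (u , e) = trans (ι-sub θ t) (sub-cong (ι t) λ x m →
     let m′ = subst (x ∈_) (vars-ι t) m in h x m′ (pure-vars t e x m′))

  -- A left inverse of ι (U-subterms are mapped to an arbitrary variable).
  mutual
    unι : TermU → TermF
    unι (H.var x) = G.var x
    unι (H.fun (inj₁ f) ts) = G.fun f (unιV ts)
    unι (H.fun (inj₂ _) _) = G.var 0

    unιV : ∀ {n} → Vec TermU n → Vec TermF n
    unιV [] = []
    unιV (t ∷ ts) = unι t ∷ unιV ts

  mutual
    unι-ι : ∀ u → unι (ι u) ≡ u
    unι-ι (G.var x) = refl
    unι-ι (G.fun f ts) = cong (G.fun f) (unιV-ιV ts)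

    unιV-ιV : ∀ {n} (ts : Vec TermF n) → unιV (ιV ts) ≡ ts
    unιV-ιV [] = refl
    unιV-ιV (t ∷ ts) = cong₂ _∷_ (unι-ι t) (unιV-ιV ts)

  mutual
    unι-sub : ∀ σ t → unι (H.sub σ (ι t)) ≡ G.sub (λ x → unι (σ x)) t
    unι-sub σ (G.var x) = refl
    unι-sub σ (G.fun f ts) = cong (G.fun f) (unιV-subV σ ts)

    unιV-subV : ∀ {n} σ (ts : Vec TermF n) → unιV (H.subV σ (ιV ts)) ≡ G.subV (λ x → unι (σ x)) ts
    unιV-subV σ [] = refl
    unιV-subV σ (t ∷ ts) = cong₂ _∷_ (unι-sub σ t) (unιV-subV σ ts)

  BelowSome : List G.Pos → G.Pos → Set
  BelowSome P q = Any (λ p → p G.≼ q) P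

  mutual
    par-sub-below : ∀ {Sr} t {τ₁ τ₂} → (∀ x → x ∈ G.vars t → H.Par Sr (τ₁ x) (τ₂ x)) →
                    H.ParGe (G.varPos t) Sr (H.sub τ₁ (ι t)) (H.sub τ₂ (ι t))
    par-sub-below (G.var x) h with h x (here refl)
    ... | Qs , p = Qs , p , All.tabulate (λ {q} _ → here (q , refl))
    par-sub-below (G.fun f ts) h with par-sub-belowV 0 ts h
    ... | Qs , pv , a = Qs , H.args pv , a

    par-sub-belowV : ∀ {Sr m} i (ts : Vec TermF m) {τ₁ τ₂} →
      (∀ x → x ∈ G.varsV ts → H.Par Sr (τ₁ x) (τ₂ x)) →
      Σ (List G.Pos) λ Qs → H.ParAtV Sr i Qs (H.subV τ₁ (ιV ts)) (H.subV τ₂ (ιV ts)) ×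
                           All (BelowSome (G.varPosV i ts)) Qs
    par-sub-belowV i [] h = [] , H.[] , []
    par-sub-belowV i (t ∷ ts) h
      with par-sub-below t (λ x m → h x (∈-++⁺ˡ m)) | par-sub-belowV (suc i) ts (λ x m → h x (∈-++⁺ʳ (G.vars t) m))
    ... | Q , p , below₁ | Qs , pv , below₂ =
      map (i ∷_) Q ++ Qs , p H.∷ pv ,
      AllP.++⁺ (All.map AnyP.++⁺ˡ (shift below₁)) (All.map (AnyP.++⁺ʳ _) below₂)
      where
      shift : ∀ {P Q} → All (BelowSome P) Q → All (BelowSome (map (i ∷_) P)) (map (i ∷_) Q)
      shift a = AllP.map⁺ (All.map (λ b → AnyP.map⁺ (Any.map (λ { (r , e) → r , cong (i ∷_) e }) b)) a)

  iter-sub-below : ∀ {Sr} n t {τ₁ τ₂} → (∀ x → x ∈ G.vars t → H.Iter n (H.Par Sr) (τ₁ x) (τ₂ x)) →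
                   H.Iter n (H.ParGe (G.varPos t) Sr) (H.sub τ₁ (ι t)) (H.sub τ₂ (ι t))
  iter-sub-below zero t h = sub-cong (ι t) λ x m → h x (subst (x ∈_) (vars-ι t) m)
  iter-sub-below (suc n) t h with iter-split-vars n (G.vars t) h
  ... | μ , initial , remaining = H.sub μ (ι t) , par-sub-below t initial , iter-sub-below n t remaining

  iter-sub : ∀ {Sr} n t {τ₁ τ₂} → (∀ x → x ∈ G.vars t → H.Iter n (H.Par Sr) (τ₁ x) (τ₂ x)) →
             H.Iter n (H.Par Sr) (H.sub τ₁ (ι t)) (H.sub τ₂ (ι t))
  iter-sub n t h = iter-map (λ { (Qs , p , _) → Qs , p }) n (iter-sub-below n t h)

module ListFacts {A : Set} where

  unique-++⁻ : ∀ {xs ys : List A} → Unique (xs ++ ys) → Unique xs × Unique ys × (∀ x → x ∈ xs → x ∈ ys → ⊥)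
  unique-++⁻ {[]} u = AllPairs.[] , u , λ x ()
  unique-++⁻ {x ∷ xs} (x∉ AllPairs.∷ u) with unique-++⁻ {xs} u
  ... | u₁ , u₂ , disjoint = (AllP.++⁻ˡ xs x∉ AllPairs.∷ u₁) , u₂ , disjoint′
    where
    disjoint′ : ∀ y → y ∈ x ∷ xs → y ∈ _ → ⊥
    disjoint′ y (here refl) m₂ = All.lookup (AllP.++⁻ʳ xs x∉) m₂ refl
    disjoint′ y (there m₁) m₂ = disjoint y m₁ m₂

  ∈-++-assoc : ∀ (xs ys zs : List A) {x} → x ∈ (xs ++ ys) ++ zs → x ∈ xs ++ (ys ++ zs)
  ∈-++-assoc xs ys zs = subst (_ ∈_) (++-assoc xs ys zs)

  drop-lookup : ∀ (cs : List A) (j : Fin (length cs)) → drop (toℕ j) cs ≡ lookup cs j ∷ drop (suc (toℕ j)) cs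
  drop-lookup (c ∷ cs) fzero = refl
  drop-lookup (c ∷ cs) (fsuc j) = drop-lookup cs j

  ∈-concatMap-take-suc : ∀ (f : A → List ℕ) (cs : List A) (i : Fin (length cs)) {x} →
    x ∈ concatMap f (take (suc (toℕ i)) cs) → x ∈ concatMap f (take (toℕ i) cs) ⊎ x ∈ f (lookup cs i)
  ∈-concatMap-take-suc f cs i {x} m
    with ∈-++⁻ (concatMap f (take (toℕ i) cs))
           (subst (x ∈_) (trans (cong (concatMap f) (take-suc cs i)) (concatMap-++ f (take (toℕ i) cs) _)) m)
  ... | inj₁ m₁ = inj₁ m₁
  ... | inj₂ m₂ = inj₂ (subst (x ∈_) (++-identityʳ _) m₂)

  All-take-suc : ∀ {P : A → Set} (cs : List A) (i : Fin (length cs)) →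
                 All P (take (toℕ i) cs) → P (lookup cs i) → All P (take (suc (toℕ i)) cs)
  All-take-suc cs i a p = subst (All _) (sym (take-suc cs i)) (AllP.++⁺ a (p ∷ []))

open ListFacts

module CondRewriting {F : Set} (ar : F → ℕ) (R : Sig.Rule ar → Set) where
  open Sig ar
  open TermFacts ar

  infix 4 _⟶*_
  _⟶*_ : TermF → TermF → Set
  _⟶*_ = Star (CArrow R)

  ⟶*-args : ∀ {g} {cs ds : Vec TermF (ar g)} → Pointwise _⟶*_ cs ds → G.fun g cs ⟶* G.fun g ds
  ⟶*-args ps = gmap (G.fun _) (λ { (N , cv) → suc N , G.cong cv }) (argsStar ps)
    where
    argsStar : ∀ {m} {cs ds : Vec TermF m} → Pointwise _⟶*_ cs ds →
               Star (λ xs ys → Σ ℕ λ N → G.CtxV (CRoot R (CStep R N)) xs ys) cs ds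
    argsStar [] = ε
    argsStar {cs = c ∷ cs} {d ∷ ds} (st ∷ ps) =
      gmap (λ x → x ∷ cs) (λ { (zero , ()) ; (suc N , s) → N , G.here s }) st ◅◅
      gmap (d ∷_) (λ { (N , cv) → N , G.there cv }) (argsStar ps)

  mutual
    ctx-map : ∀ {R₁ R₂ : G.Rel} → (∀ {u v} → R₁ u v → R₂ u v) → ∀ {u v} → G.Ctx R₁ u v → G.Ctx R₂ u v
    ctx-map f (G.root r) = G.root (f r)
    ctx-map f (G.cong cv) = G.cong (ctxV-map f cv)

    ctxV-map : ∀ {R₁ R₂ : G.Rel} → (∀ {u v} → R₁ u v → R₂ u v) →
               ∀ {m} {us vs : Vec TermF m} → G.CtxV R₁ us vs → G.CtxV R₂ us vs
    ctxV-map f (G.here c) = G.here (ctx-map f c)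
    ctxV-map f (G.there cv) = G.there (ctxV-map f cv)

  step-mono : ∀ n n′ → n ≤ n′ → ∀ {u v} → CStep R n u v → CStep R n′ u v
  step-mono zero n′ p ()
  step-mono (suc n) (suc n′) (s≤s p) = ctx-map lift-root
    where
    lift-root : ∀ {u v} → CRoot R (CStep R n) u v → CRoot R (CStep R n′) u v
    lift-root (ρ , r , σ , e₁ , e₂ , a) = ρ , r , σ , e₁ , e₂ , All.map (Star.map (step-mono n n′ p)) a

  star-level : ∀ {x y} → x ⟶* y → Σ ℕ λ N → ∀ N′ → N ≤ N′ → Star (CStep R N′) x y
  star-level ε = 0 , λ _ _ → ε
  star-level ((n , s) ◅ st) with star-level st
  ... | N , h = n ⊔ N , λ N′ p → step-mono n N′ (≤-trans (m≤m⊔n n N) p) s ◅ h N′ (≤-trans (m≤n⊔m n N) p)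

  Holds : (ℕ → TermF) → TermF × TermF → Set
  Holds θ c = G.sub θ (proj₁ c) ⟶* G.sub θ (proj₂ c)

  all-level : ∀ {θ} (cs : List (TermF × TermF)) → All (Holds θ) cs →
    Σ ℕ λ N → All (λ c → Star (CStep R N) (G.sub θ (proj₁ c)) (G.sub θ (proj₂ c))) cs
  all-level [] [] = 0 , []
  all-level (c ∷ cs) (a ∷ as) with star-level a | all-level cs as
  ... | N₁ , h₁ | N₂ , h₂ =
    N₁ ⊔ N₂ , h₁ (N₁ ⊔ N₂) (m≤m⊔n N₁ N₂) ∷
              All.map (Star.map (step-mono N₂ (N₁ ⊔ N₂) (m≤n⊔m N₁ N₂))) h₂

  rule-step : ∀ ρ → R ρ → ∀ θ → All (Holds θ) (conds ρ) → CArrow R (G.sub θ (lhs ρ)) (G.sub θ (rhs ρ))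
  rule-step ρ r θ a with all-level (conds ρ) a
  ... | N , h = suc N , G.root (ρ , r , θ , refl , refl , h)

  uncond-step : ∀ ρ → R ρ → conds ρ ≡ [] → ∀ θ → G.sub θ (lhs ρ) ⟶* G.sub θ (rhs ρ)
  uncond-step ρ r e θ = rule-step ρ r θ (subst (All (Holds θ)) (sym e) []) ◅ ε

  holds-cong : ∀ {θ θ′} cs → (∀ x → x ∈ concatMap varsC cs → θ x ≡ θ′ x) →
               All (Holds θ) cs → All (Holds θ′) cs
  holds-cong [] h [] = []
  holds-cong (c ∷ cs) h (a ∷ as) =
    subst₂ _⟶*_ (sub-cong (proj₁ c) (λ x m → h x (∈-++⁺ˡ (∈-++⁺ˡ m))))
                (sub-cong (proj₂ c) (λ x m → h x (∈-++⁺ˡ (∈-++⁺ʳ (G.vars (proj₁ c)) m)))) a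
    ∷ holds-cong cs (λ x m → h x (∈-++⁺ʳ (varsC c) m)) as

  tvars : TermF × TermF → List ℕ
  tvars c = G.vars (proj₂ c)

  det-source : ∀ X cs → Det X cs → (i : Fin (length cs)) →
               G.vars (proj₁ (lookup cs i)) ⊆ X ++ concatMap tvars (take (toℕ i) cs)
  det-source X (c ∷ cs) (d , _) fzero m = ∈-++⁺ˡ (d m)
  det-source X (c ∷ cs) (_ , ds) (fsuc i) m = ∈-++-assoc X (tvars c) _ (det-source (X ++ tvars c) cs ds i m)

  det-prefix : ∀ X cs k → Det X cs → concatMap varsC (take k cs) ⊆ X ++ concatMap tvars (take k cs)
  det-prefix X [] zero _ ()
  det-prefix X [] (suc k) _ ()
  det-prefix X (c ∷ cs) zero _ ()
  det-prefix X (c ∷ cs) (suc k) (d , ds) m with ∈-++⁻ (varsC c) m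
  ... | inj₂ m₂ = ∈-++-assoc X (tvars c) _ (det-prefix (X ++ tvars c) cs k ds m₂)
  ... | inj₁ m₁ with ∈-++⁻ (G.vars (proj₁ c)) m₁
  ...   | inj₁ ms = ∈-++⁺ˡ (d ms)
  ...   | inj₂ mt = ∈-++⁺ʳ X (∈-++⁺ˡ mt)

module UnravelingVars {F : Set} (ar : F → ℕ) (R : Sig.Rule ar → Set)
    (DT : ∀ ρ → R ρ → Sig.Deterministic ar ρ × Sig.Type3 ar ρ) where
  open Sig ar
  open Embedding ar
  open CondRewriting ar R

  src tgt : (ρ : Rule) → Fin (length (conds ρ)) → TermF
  src ρ i = proj₁ (cond ρ i)
  tgt ρ i = proj₂ (cond ρ i)

  Zτ : (τ : ℕ → TermU) (ρ : Rule) (i : Fin (length (conds ρ))) → Vec TermU (length (Zs ρ i))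
  Zτ τ ρ i = H.subV τ (V.map H.var (fromList (Zs ρ i)))

  Z⊆X : ∀ {ρ i y} → y ∈ Zs ρ i → y ∈ Xs ρ i
  Z⊆X {ρ} {i} m = ∈-deduplicate⁻ _≟_ (Xs ρ i) (proj₁ (∈-filter⁻ (λ x → x ∈? Ys ρ i) m))

  Z⊆Y : ∀ {ρ i y} → y ∈ Zs ρ i → y ∈ Ys ρ i
  Z⊆Y {ρ} {i} m = proj₂ (∈-filter⁻ (λ x → x ∈? Ys ρ i) {xs = deduplicate _≟_ (Xs ρ i)} m)

  X∩Y⊆Z : ∀ {ρ i y} → y ∈ Xs ρ i → y ∈ Ys ρ i → y ∈ Zs ρ i
  X∩Y⊆Z {ρ} {i} m₁ m₂ = ∈-filter⁺ (λ x → x ∈? Ys ρ i) (∈-deduplicate⁺ _≟_ m₁) m₂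

  Zτ-pointwise⁻ : ∀ {Rl : ℕ → TermU → Set} {τ} (xs : List ℕ) →
    Pointwise Rl (fromList xs) (H.subV τ (V.map H.var (fromList xs))) → ∀ x → x ∈ xs → Rl x (τ x)
  Zτ-pointwise⁻ (y ∷ xs) (r ∷ ps) x (here refl) = r
  Zτ-pointwise⁻ (y ∷ xs) (r ∷ ps) x (there m) = Zτ-pointwise⁻ xs ps x m

  Zτ-pointwise⁺ : ∀ {Rl : ℕ → TermU → Set} {τ} (xs : List ℕ) →
    (∀ x → x ∈ xs → Rl x (τ x)) → Pointwise Rl (fromList xs) (H.subV τ (V.map H.var (fromList xs)))
  Zτ-pointwise⁺ [] h = []
  Zτ-pointwise⁺ (y ∷ xs) h = h y (here refl) ∷ Zτ-pointwise⁺ xs (λ x m → h x (there m))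

  linear-U : ∀ ρ i t → H.Linear (Uterm ρ i (ι t)) → Unique (G.vars t ++ Zs ρ i)
  linear-U ρ i t = subst Unique (cong₂ _++_ (vars-ι t) (vars-Z (Zs ρ i)))
    where
    vars-Z : ∀ (xs : List ℕ) → H.varsV (V.map H.var (fromList xs)) ≡ xs
    vars-Z [] = refl
    vars-Z (x ∷ xs) = cong (x ∷_) (vars-Z xs)

  -- If U^ρ_i(t_i, Z_i) is linear, t_i shares no variable with X_i: every
  -- shared variable would lie in Y_i and hence in Z_i.
  tgt-fresh : ∀ ρ i {y} → Unique (G.vars (tgt ρ i) ++ Zs ρ i) → y ∈ G.vars (tgt ρ i) → ¬ (y ∈ Xs ρ i)
  tgt-fresh ρ i u mt mX =
    proj₂ (proj₂ (unique-++⁻ u)) _ mt (X∩Y⊆Z {ρ} {i} mX (∈-++⁺ʳ (G.vars (rhs ρ)) (∈-++⁺ˡ mt)))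

  src⊆X : ∀ ρ → R ρ → ∀ i {y} → y ∈ G.vars (src ρ i) → y ∈ Xs ρ i
  src⊆X ρ r i = det-source (G.vars (lhs ρ)) (conds ρ) (proj₁ (DT ρ r)) i

  rhs⊆lhs : ∀ ρ → R ρ → conds ρ ≡ [] → ∀ {y} → y ∈ G.vars (rhs ρ) → y ∈ G.vars (lhs ρ)
  rhs⊆lhs ρ r e {y} m with ∈-++⁻ (G.vars (lhs ρ)) (proj₂ (DT ρ r) m)
  ... | inj₁ m₁ = m₁
  ... | inj₂ m₂ with subst (λ cs → y ∈ concatMap varsC cs) e m₂
  ... | ()

  X₀⊆lhs : ∀ ρ (j : Fin (length (conds ρ))) → toℕ j ≡ 0 → ∀ {y} → y ∈ Xs ρ j → y ∈ G.vars (lhs ρ)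
  X₀⊆lhs ρ j e₀ {y} m with ∈-++⁻ (G.vars (lhs ρ)) m
  ... | inj₁ m₁ = m₁
  ... | inj₂ m₂ with subst (λ k → y ∈ concatMap tvars (take k (conds ρ))) e₀ m₂
  ... | ()

  X-suc : ∀ ρ (j i : Fin (length (conds ρ))) → toℕ i ≡ suc (toℕ j) →
          ∀ {y} → y ∈ Xs ρ i → y ∈ Xs ρ j ⊎ y ∈ G.vars (tgt ρ j)
  X-suc ρ j i e {y} m with ∈-++⁻ (G.vars (lhs ρ)) m
  ... | inj₁ m₁ = inj₁ (∈-++⁺ˡ m₁)
  ... | inj₂ m₂ with ∈-concatMap-take-suc tvars (conds ρ) j (subst (λ k → y ∈ concatMap tvars (take k (conds ρ))) e m₂)
  ...   | inj₁ mm = inj₁ (∈-++⁺ʳ (G.vars (lhs ρ)) mm)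
  ...   | inj₂ mt = inj₂ mt

  drop-suc : ∀ ρ (j i : Fin (length (conds ρ))) → toℕ i ≡ suc (toℕ j) →
             drop (suc (toℕ j)) (conds ρ) ≡ cond ρ i ∷ drop (suc (toℕ i)) (conds ρ)
  drop-suc ρ j i e = trans (cong (λ k → drop k (conds ρ)) (sym e)) (drop-lookup (conds ρ) i)

  src⊆Y : ∀ ρ (j i : Fin (length (conds ρ))) → toℕ i ≡ suc (toℕ j) → ∀ {y} → y ∈ G.vars (src ρ i) → y ∈ Ys ρ j
  src⊆Y ρ j i e {y} m = ∈-++⁺ʳ (G.vars (rhs ρ)) (∈-++⁺ʳ (G.vars (tgt ρ j))
     (subst (λ d → y ∈ concatMap varsC d) (sym (drop-suc ρ j i e)) (∈-++⁺ˡ (∈-++⁺ˡ m))))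

  Y-suc : ∀ ρ (j i : Fin (length (conds ρ))) → toℕ i ≡ suc (toℕ j) → ∀ {y} → y ∈ Ys ρ i → y ∈ Ys ρ j
  Y-suc ρ j i e {y} m with ∈-++⁻ (G.vars (rhs ρ)) m
  ... | inj₁ m₁ = ∈-++⁺ˡ m₁
  ... | inj₂ m₂ = ∈-++⁺ʳ (G.vars (rhs ρ)) (∈-++⁺ʳ (G.vars (tgt ρ j))
        (subst (λ d → y ∈ concatMap varsC d) (sym (drop-suc ρ j i e)) (later (∈-++⁻ (G.vars (tgt ρ i)) m₂))))
    where
    later : y ∈ G.vars (tgt ρ i) ⊎ y ∈ concatMap varsC (drop (suc (toℕ i)) (conds ρ)) →
            y ∈ varsC (cond ρ i) ++ concatMap varsC (drop (suc (toℕ i)) (conds ρ))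
    later (inj₁ mt) = ∈-++⁺ˡ (∈-++⁺ʳ (G.vars (src ρ i)) mt)
    later (inj₂ md) = ∈-++⁺ʳ (varsC (cond ρ i)) md

  take-last : ∀ ρ (i : Fin (length (conds ρ))) → suc (toℕ i) ≡ length (conds ρ) → take (suc (toℕ i)) (conds ρ) ≡ conds ρ
  take-last ρ i e = take-all (suc (toℕ i)) (conds ρ) (≤-reflexive (sym e))

  rhs⊆X∪tgt : ∀ ρ → R ρ → (i : Fin (length (conds ρ))) → suc (toℕ i) ≡ length (conds ρ) → ∀ {y} →
              y ∈ G.vars (rhs ρ) → y ∈ Xs ρ i ⊎ y ∈ G.vars (tgt ρ i)
  rhs⊆X∪tgt ρ r i e {y} m with ∈-++⁻ (G.vars (lhs ρ)) (proj₂ (DT ρ r) m)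
  ... | inj₁ m₁ = inj₁ (∈-++⁺ˡ m₁)
  ... | inj₂ m₂ with ∈-concatMap-take-suc varsC (conds ρ) i (subst (λ d → y ∈ concatMap varsC d) (sym (take-last ρ i e)) m₂)
  ...   | inj₁ mm = inj₁ (det-prefix (G.vars (lhs ρ)) (conds ρ) (toℕ i) (proj₁ (DT ρ r)) mm)
  ...   | inj₂ mc with ∈-++⁻ (G.vars (src ρ i)) mc
  ...     | inj₁ ms = inj₁ (src⊆X ρ r i ms)
  ...     | inj₂ mt = inj₂ mt

module Decomposition {F : Set} (ar : F → ℕ) (R : Sig.Rule ar → Set) where
  open Sig ar
  open TermFacts ar using (sub-cong; subV-cong)
  open TermFacts arU using (iter-par-suc) renaming (subV-cong to subV-congᵁ)
  open Embedding ar
  open CondRewriting ar R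

  infix 4 _⇉⟨_⟩_
  _⇉⟨_⟩_ : TermU → ℕ → TermU → Set
  u ⇉⟨ n ⟩ v = H.Iter n (H.Par (Uopt R)) u v

  Tracks : ℕ → (ℕ → TermF) → (ℕ → TermU) → ℕ → Set
  Tracks n θ σ x = ι (θ x) ⇉⟨ n ⟩ σ x × (Pure (σ x) → ι (θ x) ≡ σ x)

  Decomp : ℕ → TermF → TermF → (ℕ → TermU) → Set
  Decomp n t a σ = Σ (ℕ → TermF) λ θ → a ⟶* G.sub θ t × (∀ x → x ∈ G.vars t → Tracks n θ σ x)

  Decomposition : ℕ → Set
  Decomposition n = ∀ s t σ → G.Linear t → ι s ⇉⟨ n ⟩ H.sub σ (ι t) → Decomp n t s σ

  decomp-pre : ∀ {n t a b σ} → a ⟶* b → Decomp n t b σ → Decomp n t a σ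
  decomp-pre st (θ , st′ , h) = θ , st ◅◅ st′ , h

  decomp-suc : ∀ {n t a σ} → Decomp n t a σ → Decomp (suc n) t a σ
  decomp-suc {n} (θ , st , h) = θ , st , λ x m → iter-par-suc n (proj₁ (h x m)) , proj₂ (h x m)

  decomp-impure-var : ∀ {n b σ x} → ι b ⇉⟨ n ⟩ σ x → ¬ Pure (σ x) → Decomp n (G.var x) b σ
  decomp-impure-var {b = b} it impure = (λ _ → b) , ε , λ { x (here refl) → it , λ p → ⊥-elim (impure p) }

  decomposition-0 : Decomposition 0
  decomposition-0 s t σ lin e = (λ x → unι (σ x)) , subst (s ⟶*_) s≡tθ ε ,
    λ x m → let p = pure-vars t e x m in unι-pure p , λ _ → unι-pure p
    where
    s≡tθ : s ≡ G.sub (λ x → unι (σ x)) t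
    s≡tθ = trans (sym (unι-ι s)) (trans (cong unι e) (unι-sub σ t))
    unι-pure : ∀ {w} → Pure w → ι (unι w) ≡ w
    unι-pure (u , refl) = cong ι (unι-ι u)

  ι-sub-steps : ∀ {m θ τ} u → (∀ y → y ∈ G.vars u → ι (θ y) ⇉⟨ m ⟩ τ y) →
                ι (G.sub θ u) ⇉⟨ m ⟩ H.sub τ (ι u)
  ι-sub-steps {m} {θ} {τ} u h = subst (_⇉⟨ m ⟩ H.sub τ (ι u)) (sym (ι-sub θ u)) (iter-sub m u h)

  decomp-var-instance : ∀ {n b x t′ σ σ′} → σ x ≡ H.sub σ′ (ι t′) → Decomp n t′ b σ′ →
                        Decomp n (G.var x) b σ
  decomp-var-instance {n} {b} {x} {t′} {σ} {σ′} e (θ′ , st , h) = (λ _ → G.sub θ′ t′) , st ,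
    λ { y (here refl) →
          subst (ι (G.sub θ′ t′) ⇉⟨ n ⟩_) (sym e)
                (ι-sub-steps t′ (λ z m → proj₁ (h z m))) ,
          λ p → trans (ι-sub-pure θ′ σ′ t′ (λ z m → proj₂ (h z m)) (subst Pure e p)) (sym e) }

  argPat : ℕ → (m : ℕ) → Vec TermF m
  argPat i zero = []
  argPat i (suc m) = G.var i ∷ argPat (suc i) m

  argPat-sub : ∀ {m} → ℕ → Vec TermU m → ℕ → TermU
  argPat-sub i [] x = H.var x
  argPat-sub i (v ∷ vs) x with x ≟ i
  ... | yes _ = v
  ... | no _ = argPat-sub (suc i) vs x

  argPat-sub-here : ∀ {m} i v (vs : Vec TermU m) → argPat-sub i (v ∷ vs) i ≡ v
  argPat-sub-here i v vs with i ≟ i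
  ... | yes _ = refl
  ... | no i≢i = ⊥-elim (i≢i refl)

  argPat-sub-there : ∀ {m} i x v (vs : Vec TermU m) → x ≢ i → argPat-sub i (v ∷ vs) x ≡ argPat-sub (suc i) vs x
  argPat-sub-there i x v vs x≢i with x ≟ i
  ... | yes x≡i = ⊥-elim (x≢i x≡i)
  ... | no _ = refl

  argPat-vars-≥ : ∀ i m {x} → x ∈ G.varsV (argPat i m) → i ≤ x
  argPat-vars-≥ i (suc m) (here refl) = ≤-refl
  argPat-vars-≥ i (suc m) (there mm) = ≤-trans (n≤1+n i) (argPat-vars-≥ (suc i) m mm)

  argPat-linear : ∀ i m → Unique (G.varsV (argPat i m))
  argPat-linear i zero = AllPairs.[]
  argPat-linear i (suc m) =
    All.tabulate (λ mm e → >⇒≢ (argPat-vars-≥ (suc i) m mm) (sym e)) AllPairs.∷ argPat-linear (suc i) m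

  argPat-instance : ∀ i {m} (vs : Vec TermU m) → H.subV (argPat-sub i vs) (ιV (argPat i m)) ≡ vs
  argPat-instance i [] = refl
  argPat-instance i {suc m} (v ∷ vs) = cong₂ _∷_ (argPat-sub-here i v vs)
    (trans (subV-congᵁ (ιV (argPat (suc i) m)) λ x mm →
       argPat-sub-there i x v vs (>⇒≢ (argPat-vars-≥ (suc i) m (subst (x ∈_) (varsV-ι (argPat (suc i) m)) mm))))
     (argPat-instance (suc i) vs))

  argPat-tracks : ∀ {k} θ i {m} (us : Vec TermU m) →
    (∀ x → x ∈ G.varsV (argPat i m) → ι (θ x) ⇉⟨ k ⟩ argPat-sub i us x) →
    Pointwise (λ c u → ι c ⇉⟨ k ⟩ u) (G.subV θ (argPat i m)) us
  argPat-tracks θ i [] h = []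
  argPat-tracks {k} θ i {suc m} (u ∷ us) h =
    subst (ι (θ i) ⇉⟨ k ⟩_) (argPat-sub-here i u us) (h i (here refl)) ∷
    argPat-tracks θ (suc i) us (λ x mm →
      subst (ι (θ x) ⇉⟨ k ⟩_) (argPat-sub-there i x u us (>⇒≢ (argPat-vars-≥ (suc i) m mm))) (h x (there mm)))

  decompose-fun : ∀ {k} → Decomposition k → ∀ {b g} {us : Vec TermU (ar g)} → ι b ⇉⟨ k ⟩ H.fun (inj₁ g) us →
    Σ (Vec TermF (ar g)) λ cs → b ⟶* G.fun g cs × Pointwise (λ c u → ι c ⇉⟨ k ⟩ u) cs us
  decompose-fun {k} dec {b} {g} {us} it
    with dec b (G.fun g (argPat 0 (ar g))) (argPat-sub 0 us) (argPat-linear 0 (ar g))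
             (subst (ι b ⇉⟨ k ⟩_) (sym (cong (H.fun (inj₁ g)) (argPat-instance 0 us))) it)
  ... | θ , st , h = G.subV θ (argPat 0 (ar g)) , st , argPat-tracks θ 0 us (λ x mm → proj₁ (h x mm))

  DecompV : ∀ {m} → ℕ → Vec TermF m → Vec TermF m → (ℕ → TermU) → Set
  DecompV n ts cs σ = Σ (ℕ → TermF) λ θ →
    Pointwise _⟶*_ cs (G.subV θ ts) × (∀ x → x ∈ G.varsV ts → Tracks n θ σ x)

  override : List ℕ → (ℕ → TermF) → (ℕ → TermF) → ℕ → TermF
  override X θ θ′ y with y ∈? X
  ... | yes _ = θ y
  ... | no _ = θ′ y

  override-in : ∀ X θ θ′ y → y ∈ X → override X θ θ′ y ≡ θ y
  override-in X θ θ′ y m with y ∈? X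
  ... | yes _ = refl
  ... | no y∉ = ⊥-elim (y∉ m)

  override-out : ∀ X θ θ′ y → ¬ (y ∈ X) → override X θ θ′ y ≡ θ′ y
  override-out X θ θ′ y y∉ with y ∈? X
  ... | yes m = ⊥-elim (y∉ m)
  ... | no _ = refl

  decompV-cons : ∀ {n m t c σ} {ts cs : Vec TermF m} → Decomp n t c σ → DecompV n ts cs σ →
                 (∀ x → x ∈ G.vars t → x ∈ G.varsV ts → ⊥) → DecompV n (t ∷ ts) (c ∷ cs) σ
  decompV-cons {n} {t = t} {σ = σ} {ts} (θ₁ , st₁ , h₁) (θ₂ , st₂ , h₂) disjoint =
    θ , (subst (_ ⟶*_) (sym (sub-cong t (λ x mm → override-in (G.vars t) θ₁ θ₂ x mm))) st₁ ∷
         subst (Pointwise _⟶*_ _)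
               (sym (subV-cong ts (λ x mm → override-out (G.vars t) θ₁ θ₂ x (λ m₁ → disjoint x m₁ mm)))) st₂) ,
    tracks
    where
    θ = override (G.vars t) θ₁ θ₂
    tracks : ∀ x → x ∈ G.vars t ++ G.varsV ts → Tracks n θ σ x
    tracks x mm with ∈-++⁻ (G.vars t) mm
    ... | inj₁ m₁ rewrite override-in (G.vars t) θ₁ θ₂ x m₁ = h₁ x m₁
    ... | inj₂ m₂ rewrite override-out (G.vars t) θ₁ θ₂ x (λ m₁ → disjoint x m₁ m₂) = h₂ x m₂

  decomp-fun : ∀ {n g a σ} {ts cs : Vec TermF (ar g)} → DecompV n ts cs σ → a ⟶* G.fun g cs → Decomp n (G.fun g ts) a σ
  decomp-fun (θ , ps , h) st = θ , st ◅◅ ⟶*-args ps , h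

-- Reductions ι b ⇉ᵐ U^ρ_i(v, zs) to a partially evaluated rule application:
-- they arise from b ⟶* lθ where θ satisfies the first i conditions of ρ.
-- The induction hypothesis of the main induction is passed in as `Below m`.
module PartialApplication {F : Set} (ar : F → ℕ) (R : Sig.Rule ar → Set)
    (ULL : ∀ ρ → R ρ → Sig.UoptLL ar ρ)
    (DT : ∀ ρ → R ρ → Sig.Deterministic ar ρ × Sig.Type3 ar ρ) where
  open Sig ar
  open TermFacts ar using (sub-cong)
  open TermFacts arU using (iter-snoc; iter-unsnoc; iter-par-pad; iter-par-suc; par-inversion)
  open Embedding ar
  open CondRewriting ar R
  open UnravelingVars ar R DT
  open Decomposition ar R

  Below : ℕ → Set
  Below m = ∀ k → k < m → Decomposition k

  below-pred : ∀ {m} → Below (suc m) → Below m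
  below-pred ih k lt = ih k (m<n⇒m<1+n lt)

  Stage : ℕ → TermF → (ρ : Rule) → (i : Fin (length (conds ρ))) → TermU → Vec TermU (length (Zs ρ i)) → Set
  Stage m b ρ i v zs = Σ (ℕ → TermF) λ θ → R ρ × b ⟶* G.sub θ (lhs ρ) × All (Holds θ) (take (toℕ i) (conds ρ)) ×
    (Σ ℕ λ m′ → m′ < m × ι (G.sub θ (src ρ i)) ⇉⟨ m′ ⟩ v) ×
    Pointwise (λ x z → ι (θ x) ⇉⟨ m ⟩ z) (fromList (Zs ρ i)) zs

  stage-pre : ∀ {m a b ρ i v zs} → a ⟶* b → Stage m b ρ i v zs → Stage (suc m) a ρ i v zs
  stage-pre {m} st (θ , r , st′ , holds , (m′ , lt , itv) , zs) =
    θ , r , st ◅◅ st′ , holds , (m′ , m<n⇒m<1+n lt , itv) , PW.map (iter-par-suc m) zs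

  linear-stage : ∀ ρ → R ρ → ∀ j {r′} → URule ρ (Uterm ρ j (ι (tgt ρ j))) r′ → Unique (G.vars (tgt ρ j) ++ Zs ρ j)
  linear-stage ρ r j u = linear-U ρ j (tgt ρ j) (ULL ρ r _ _ u)

  -- Merging θ (stage i) with a θ′ for which s_iθ ⟶* t_iθ′ yields stage i + 1;
  -- this is well defined since t_i is variable-disjoint from X_i.
  merge-condition : ∀ {b} ρ (i : Fin (length (conds ρ))) θ θ′ → R ρ → Unique (G.vars (tgt ρ i) ++ Zs ρ i) →
    b ⟶* G.sub θ (lhs ρ) → All (Holds θ) (take (toℕ i) (conds ρ)) → G.sub θ (src ρ i) ⟶* G.sub θ′ (tgt ρ i) →
    let θ* = override (Xs ρ i) θ θ′ in
    b ⟶* G.sub θ* (lhs ρ) × All (Holds θ*) (take (suc (toℕ i)) (conds ρ)) ×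
    (∀ y → y ∈ Xs ρ i → θ* y ≡ θ y) × (∀ y → y ∈ G.vars (tgt ρ i) → θ* y ≡ θ′ y)
  merge-condition {b} ρ i θ θ′ r u st holds st′ =
    subst (b ⟶*_) (sub-cong (lhs ρ) (λ y m → sym (on-X y (∈-++⁺ˡ m)))) st ,
    All-take-suc (conds ρ) i
      (holds-cong (take (toℕ i) (conds ρ))
        (λ y m → sym (on-X y (det-prefix (G.vars (lhs ρ)) (conds ρ) (toℕ i) (proj₁ (DT ρ r)) m))) holds)
      (subst₂ _⟶*_ (sub-cong (src ρ i) (λ y m → sym (on-X y (src⊆X ρ r i m))))
                   (sub-cong (tgt ρ i) (λ y m → sym (on-t y m))) st′) ,
    on-X , on-t
    where
    on-X : ∀ y → y ∈ Xs ρ i → override (Xs ρ i) θ θ′ y ≡ θ y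
    on-X y = override-in (Xs ρ i) θ θ′ y
    on-t : ∀ y → y ∈ G.vars (tgt ρ i) → override (Xs ρ i) θ θ′ y ≡ θ′ y
    on-t y m = override-out (Xs ρ i) θ θ′ y (tgt-fresh ρ i u m)

  stage-args : ∀ {m b ρ i v v′ zs zs′} → Stage m b ρ i v′ zs′ → H.Par (Uopt R) v′ v →
               Pointwise (H.Par (Uopt R)) zs′ zs → Stage (suc m) b ρ i v zs
  stage-args {m} (θ , r , st , holds , (m′ , lt , itv) , pzs) pv pvs =
    θ , r , st , holds , (suc m′ , s≤s lt , iter-snoc m′ itv pv) , extend pzs pvs
    where
    extend : ∀ {n} {xs : Vec ℕ n} {ys zs : Vec TermU n} →
             Pointwise (λ x z → ι (θ x) ⇉⟨ m ⟩ z) xs ys → Pointwise (H.Par (Uopt R)) ys zs →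
             Pointwise (λ x z → ι (θ x) ⇉⟨ suc m ⟩ z) xs zs
    extend [] [] = []
    extend (a ∷ as) (p ∷ ps) = iter-snoc m a p ∷ extend as ps

  rhs-var : ∀ {τ p zs} t → H.fun (inj₂ p) zs ≡ H.sub τ (ι t) → Σ ℕ λ x → t ≡ G.var x
  rhs-var (G.var x) e = x , refl
  rhs-var (G.fun f ts) ()

  -- The last step is a root step l′τ → xτ with an unconditional rule of R
  -- (x ∈ Var(l′) by Type 3): simulate it and continue from xθ₁.
  stage-uncond : ∀ {m b ρ i v zs} ρ′ → R ρ′ → conds ρ′ ≡ [] → ∀ τ → ι b ⇉⟨ m ⟩ H.sub τ (ι (lhs ρ′)) →
    H.fun (inj₂ (ρ , i)) (v ∷ zs) ≡ H.sub τ (ι (rhs ρ′)) → Decomposition m →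
    (∀ b′ → ι b′ ⇉⟨ m ⟩ H.fun (inj₂ (ρ , i)) (v ∷ zs) → Stage m b′ ρ i v zs) → Stage (suc m) b ρ i v zs
  stage-uncond {m} {b} ρ′ r e τ it e₂ dec continue
    with rhs-var (rhs ρ′) e₂ | dec b (lhs ρ′) τ (linear-ι⁻ (lhs ρ′) (ULL ρ′ r _ _ (uncond e))) it
  ... | x , rhs≡x | θ₁ , st₁ , h₁ =
    stage-pre (subst (b ⟶*_) (cong (G.sub θ₁) rhs≡x) (st₁ ◅◅ uncond-step ρ′ r e θ₁))
      (continue (θ₁ x) (subst (ι (θ₁ x) ⇉⟨ m ⟩_) (sym (trans e₂ (cong (λ q → H.sub τ (ι q)) rhs≡x)))
                                (proj₁ (h₁ x x∈lhs))))
    where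
    x∈lhs : x ∈ G.vars (lhs ρ′)
    x∈lhs = rhs⊆lhs ρ′ r e (subst (λ q → x ∈ G.vars q) (sym rhs≡x) (here refl))

  stage-first : ∀ {m b} ρ → R ρ → (j : Fin (length (conds ρ))) → toℕ j ≡ 0 → ∀ τ → ι b ⇉⟨ m ⟩ H.sub τ (ι (lhs ρ)) →
                Decomposition m → Stage (suc m) b ρ j (H.sub τ (ι (src ρ j))) (Zτ τ ρ j)
  stage-first {m} {b} ρ r j e₀ τ it dec with dec b (lhs ρ) τ (linear-ι⁻ (lhs ρ) (ULL ρ r _ _ (first j e₀))) it
  ... | θ , st , h = θ , r , st , subst (λ k → All (Holds θ) (take k (conds ρ))) (sym e₀) [] ,
      (m , ≤-refl , ι-sub-steps (src ρ j) (λ y my → proj₁ (h y (X₀⊆lhs ρ j e₀ (src⊆X ρ r j my))))) ,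
      Zτ-pointwise⁺ (Zs ρ j) (λ y my → iter-par-suc m (proj₁ (h y (X₀⊆lhs ρ j e₀ (Z⊆X {ρ} {j} my)))))

  -- The last step is U^ρ_j(t_jτ, Z_jτ) → U^ρ_{j+1}(s_{j+1}τ, Z_{j+1}τ): decompose
  -- s_jθ along t_j and merge, establishing condition j.
  stage-middle : ∀ {m b} ρ → (j i : Fin (length (conds ρ))) → toℕ i ≡ suc (toℕ j) → ∀ τ →
                 Stage m b ρ j (H.sub τ (ι (tgt ρ j))) (Zτ τ ρ j) → Below m →
                 Stage (suc m) b ρ i (H.sub τ (ι (src ρ i))) (Zτ τ ρ i)
  stage-middle {m} {b} ρ j i e τ (θ , r , st , holds , (m′ , lt , itv) , pzs) ih
    with ih m′ lt (G.sub θ (src ρ j)) (tgt ρ j) τ (proj₁ (unique-++⁻ (linear-stage ρ r j (middle j i e)))) itv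
  ... | θ′ , st′ , h′ with merge-condition ρ j θ θ′ r (linear-stage ρ r j (middle j i e)) st holds st′
  ... | st* , holds* , on-X , on-t =
    θ* , r , st* , subst (λ k → All (Holds θ*) (take k (conds ρ))) (sym e) holds* ,
    (m , ≤-refl , ι-sub-steps (src ρ i) (λ y my → tracks y (src⊆X ρ r i my) (src⊆Y ρ j i e my))) ,
    Zτ-pointwise⁺ (Zs ρ i) (λ y my → iter-par-suc m (tracks y (Z⊆X {ρ} {i} my) (Y-suc ρ j i e (Z⊆Y {ρ} {i} my))))
    where
    θ* = override (Xs ρ j) θ θ′
    tracks : ∀ y → y ∈ Xs ρ i → y ∈ Ys ρ j → ι (θ* y) ⇉⟨ m ⟩ τ y
    tracks y mx my with X-suc ρ j i e mx
    ... | inj₁ mxj =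
      subst (λ q → ι q ⇉⟨ m ⟩ τ y) (sym (on-X y mxj)) (Zτ-pointwise⁻ (Zs ρ j) pzs y (X∩Y⊆Z {ρ} {j} mxj my))
    ... | inj₂ mt = subst (λ q → ι q ⇉⟨ m ⟩ τ y) (sym (on-t y mt)) (iter-par-pad m′ m (<⇒≤ lt) (proj₁ (h′ y mt)))

  fire-rule : ∀ {m b} ρ i τ → suc (toℕ i) ≡ length (conds ρ) → Below m →
              Stage m b ρ i (H.sub τ (ι (tgt ρ i))) (Zτ τ ρ i) →
              Σ TermF λ c → b ⟶* c × ι c ⇉⟨ m ⟩ H.sub τ (ι (rhs ρ))
  fire-rule {m} {b} ρ i τ e ih (θ , r , st , holds , (m′ , lt , itv) , pzs)
    with ih m′ lt (G.sub θ (src ρ i)) (tgt ρ i) τ (proj₁ (unique-++⁻ (linear-stage ρ r i (final i e)))) itv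
  ... | θ′ , st′ , h′ with merge-condition ρ i θ θ′ r (linear-stage ρ r i (final i e)) st holds st′
  ... | st* , holds* , on-X , on-t =
    G.sub θ* (rhs ρ) , st* ◅◅ (rule-step ρ r θ* (subst (All (Holds θ*)) (take-last ρ i e) holds*) ◅ ε) ,
    ι-sub-steps (rhs ρ) tracks
    where
    θ* = override (Xs ρ i) θ θ′
    tracks : ∀ y → y ∈ G.vars (rhs ρ) → ι (θ* y) ⇉⟨ m ⟩ τ y
    tracks y my with rhs⊆X∪tgt ρ r i e my
    ... | inj₁ mx =
      subst (λ q → ι q ⇉⟨ m ⟩ τ y) (sym (on-X y mx)) (Zτ-pointwise⁻ (Zs ρ i) pzs y (X∩Y⊆Z {ρ} {i} mx (∈-++⁺ˡ my)))
    ... | inj₂ mt = subst (λ q → ι q ⇉⟨ m ⟩ τ y) (sym (on-t y mt)) (iter-par-pad m′ m (<⇒≤ lt) (proj₁ (h′ y mt)))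

  -- Every reduction ι b ⇉ᵐ U^ρ_i(v, zs) comes from a stage, by induction on m
  -- and case analysis of the last step; simultaneously, a reduction to the
  -- final U-term of a rule can be replaced by an application of the rule.
  mutual
    stage : ∀ m → Below m → ∀ b ρ i v zs → ι b ⇉⟨ m ⟩ H.fun (inj₂ (ρ , i)) (v ∷ zs) → Stage m b ρ i v zs
    stage zero ih b ρ i v zs it = ⊥-elim (U-impure b it)
    stage (suc m) ih b ρ i v zs it with iter-unsnoc m it
    ... | w , it₀ , (Qs , pa) with par-inversion pa
    ... | inj₁ (v′ ∷ zs′ , refl , pv ∷ pzs) = stage-args (stage m (below-pred ih) b ρ i v′ zs′ it₀) pv pzs
    ... | inj₂ (_ , _ , (ρ′ , r′ , uncond e) , τ , refl , e₂) =
          stage-uncond ρ′ r′ e τ it₀ e₂ (ih m ≤-refl) (λ b′ → stage m (below-pred ih) b′ ρ i v zs)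
    ... | inj₂ (_ , _ , (ρ′ , r′ , first j e₀) , τ , refl , refl) = stage-first ρ′ r′ j e₀ τ it₀ (ih m ≤-refl)
    ... | inj₂ (_ , _ , (ρ′ , r′ , middle j j′ e) , τ , refl , refl) =
          stage-middle ρ′ j j′ e τ (stage m (below-pred ih) b ρ′ j _ _ it₀) (below-pred ih)
    ... | inj₂ (_ , _ , (ρ′ , r′ , final j e) , τ , refl , e₂) with final-step m (below-pred ih) ρ′ j τ e it₀
    ...   | c , st , itc = stage-pre st (stage m (below-pred ih) c ρ i v zs (subst (ι c ⇉⟨ m ⟩_) (sym e₂) itc))

    final-step : ∀ m → Below m → ∀ {b} ρ i τ → suc (toℕ i) ≡ length (conds ρ) →
                 ι b ⇉⟨ m ⟩ H.sub τ (Uterm ρ i (ι (tgt ρ i))) →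
                 Σ TermF λ c → b ⟶* c × ι c ⇉⟨ m ⟩ H.sub τ (ι (rhs ρ))
    final-step m ih {b} ρ i τ e it = fire-rule ρ i τ e ih (stage m ih b ρ i _ _ it)

module LastStep {F : Set} (ar : F → ℕ) (R : Sig.Rule ar → Set)
    (ULL : ∀ ρ → R ρ → Sig.UoptLL ar ρ)
    (DT : ∀ ρ → R ρ → Sig.Deterministic ar ρ × Sig.Type3 ar ρ) where
  open Sig ar
  open TermFacts arU using (iter-snoc; iter-unsnoc; par-refl; par-args)
  open Embedding ar
  open CondRewriting ar R
  open UnravelingVars ar R DT
  open Decomposition ar R
  open PartialApplication ar R ULL DT

  Resolved : ℕ → TermU → TermU → Set
  Resolved k u v = H.Par (Uopt R) u v ×
    (∀ b t σ → G.Linear t → ι b ⇉⟨ k ⟩ u → v ≡ H.sub σ (ι t) → Decomp (suc k) t b σ)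

  module _ (k : ℕ) (ih : Below (suc k)) where
    dec-k : Decomposition k
    dec-k = ih k ≤-refl

    -- Argument-wise resolution along a linear vector ts: decompose each
    -- argument separately and merge (the arguments are variable-disjoint).
    decompV-args : ∀ {m σ} (ts cs : Vec TermF m) {us vs : Vec TermU m} → Unique (G.varsV ts) →
      Pointwise (Resolved k) us vs → Pointwise (λ c u → ι c ⇉⟨ k ⟩ u) cs us → vs ≡ H.subV σ (ιV ts) →
      DecompV (suc k) ts cs σ
    decompV-args [] [] lin [] [] eq = (λ x → G.var x) , [] , λ x ()
    decompV-args {σ = σ} (t ∷ ts) (c ∷ cs) lin (res ∷ ress) (it ∷ its) eq with unique-++⁻ {xs = G.vars t} lin
    ... | lin-t , lin-ts , disjoint =
      decompV-cons {t = t} (proj₂ res c t σ lin-t it (cong V.head eq))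
                   (decompV-args ts cs lin-ts ress its (cong V.tail eq)) disjoint

    decomp-fun-args : ∀ {g b σ} {us vs : Vec TermU (ar g)} (ts : Vec TermF (ar g)) → Pointwise (Resolved k) us vs →
      ι b ⇉⟨ k ⟩ H.fun (inj₁ g) us → vs ≡ H.subV σ (ιV ts) → Unique (G.varsV ts) → Decomp (suc k) (G.fun g ts) b σ
    decomp-fun-args ts ress it eq lin with decompose-fun dec-k it
    ... | cs , st , its = decomp-fun (decompV-args ts cs lin ress its eq) st

    -- t is a variable x with xσ = f(vs): trivial if f is a U-symbol, otherwise
    -- go through the linear pattern f(x_0, …, x_{m-1}).
    decomp-var-args : ∀ f {us vs : Vec TermU (arU f)} → Pointwise (Resolved k) us vs → ∀ b x σ →
      ι b ⇉⟨ k ⟩ H.fun f us → H.fun f vs ≡ σ x → Decomp (suc k) (G.var x) b σ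
    decomp-var-args (inj₂ p) ress b x σ it eq =
      decomp-impure-var (subst (ι b ⇉⟨ suc k ⟩_) eq (iter-snoc k it (par-args (PW.map proj₁ ress))))
                        (λ { (u , e) → U-impure u (trans e (sym eq)) })
    decomp-var-args (inj₁ g) {vs = vs} ress b x σ it eq =
      decomp-var-instance {t′ = G.fun g (argPat 0 (ar g))} {σ′ = argPat-sub 0 vs}
        (trans (sym eq) (sym (cong (H.fun (inj₁ g)) (argPat-instance 0 vs))))
        (decomp-fun-args (argPat 0 (ar g)) ress it (sym (argPat-instance 0 vs)) (argPat-linear 0 (ar g)))

    resolved-args : ∀ {f} {us vs : Vec TermU (arU f)} → Pointwise (Resolved k) us vs → Resolved k (H.fun f us) (H.fun f vs)
    resolved-args {f} ress = par-args (PW.map proj₁ ress) , resolve-along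
      where
      resolve-along : ∀ b t σ → G.Linear t → ι b ⇉⟨ k ⟩ H.fun f _ → H.fun f _ ≡ H.sub σ (ι t) → Decomp (suc k) t b σ
      resolve-along b (G.var x) σ lin it eq = decomp-var-args f ress b x σ it eq
      resolve-along b (G.fun g ts) σ lin it eq with fun-injective eq
      ... | refl , eq′ = decomp-fun-args ts ress it eq′ lin

    decomp-U-result : ∀ {p zs u} t {b σ} → H.Par (Uopt R) u (H.fun (inj₂ p) zs) → ι b ⇉⟨ k ⟩ u →
                      H.fun (inj₂ p) zs ≡ H.sub σ (ι t) → Decomp (suc k) t b σ
    decomp-U-result (G.var x) {b} par it eq =
      decomp-impure-var (subst (ι b ⇉⟨ suc k ⟩_) eq (iter-snoc k it par)) (λ { (u , e) → U-impure u (trans e (sym eq)) })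
    decomp-U-result (G.fun g ts) par it ()

    resolved-root : ∀ {u v} → H.RootStep (Uopt R) u v → Resolved k u v
    resolved-root rs = (([] ∷ []) , H.step (H.root rs)) , resolve-root rs
      where
      resolve-root : ∀ {u v} → H.RootStep (Uopt R) u v → ∀ b t σ → G.Linear t → ι b ⇉⟨ k ⟩ u → v ≡ H.sub σ (ι t) →
                     Decomp (suc k) t b σ
      -- an unconditional rule l → r: decompose along l, apply the rule,
      -- and decompose the reduct along t
      resolve-root (_ , _ , (ρ , r , uncond e) , τ , refl , refl) b t σ lin it eq
        with dec-k b (lhs ρ) τ (linear-ι⁻ (lhs ρ) (ULL ρ r _ _ (uncond e))) it
      ... | θ₁ , st₁ , h₁ =
        decomp-suc {t = t} (decomp-pre {t = t} (st₁ ◅◅ uncond-step ρ r e θ₁)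
                              (dec-k (G.sub θ₁ (rhs ρ)) t σ lin (subst (ι (G.sub θ₁ (rhs ρ)) ⇉⟨ k ⟩_) eq rhs-steps)))
        where
        rhs-steps : ι (G.sub θ₁ (rhs ρ)) ⇉⟨ k ⟩ H.sub τ (ι (rhs ρ))
        rhs-steps = ι-sub-steps (rhs ρ) (λ y m → proj₁ (h₁ y (rhs⊆lhs ρ r e m)))
      resolve-root rs@(_ , _ , (ρ , r , first i e₀) , τ , refl , refl) b t σ lin it eq =
        decomp-U-result t (_ , H.step (H.root rs)) it eq
      resolve-root rs@(_ , _ , (ρ , r , middle i j e) , τ , refl , refl) b t σ lin it eq =
        decomp-U-result t (_ , H.step (H.root rs)) it eq
      -- the final rule of U_opt(ρ): replace it by an application of ρ
      resolve-root (_ , _ , (ρ , r , final i e) , τ , refl , refl) b t σ lin it eq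
        with final-step k (below-pred ih) ρ i τ e it
      ... | c , st , itc = decomp-suc {t = t} (decomp-pre {t = t} st (dec-k c t σ lin (subst (ι c ⇉⟨ k ⟩_) eq itc)))

    resolved-refl : ∀ {u} → Resolved k u u
    resolved-refl = par-refl , λ b t σ lin it eq → decomp-suc {t = t} (dec-k b t σ lin (subst (ι b ⇉⟨ k ⟩_) eq it))

    mutual
      resolve : ∀ {Qs u v} → H.ParAt (Uopt R) Qs u v → Resolved k u v
      resolve H.none = resolved-refl
      resolve (H.step st) = resolve-step st
      resolve (H.args pv) = resolved-args (resolveV pv)

      resolveV : ∀ {m i Qs} {us vs : Vec TermU m} → H.ParAtV (Uopt R) i Qs us vs → Pointwise (Resolved k) us vs
      resolveV H.[] = []
      resolveV (p H.∷ pv) = resolve p ∷ resolveV pv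

      resolve-step : ∀ {u v} → H.Ctx (H.RootStep (Uopt R)) u v → Resolved k u v
      resolve-step (H.root rs) = resolved-root rs
      resolve-step (H.cong cv) = resolved-args (resolve-ctxV cv)

      resolve-ctxV : ∀ {m} {us vs : Vec TermU m} → H.CtxV (H.RootStep (Uopt R)) us vs → Pointwise (Resolved k) us vs
      resolve-ctxV (H.here c) = resolve-step c ∷ PW.refl resolved-refl
      resolve-ctxV (H.there cv) = resolved-refl ∷ resolve-ctxV cv

  decomposition-step : ∀ n → Below n → Decomposition n
  decomposition-step zero ih = decomposition-0
  decomposition-step (suc k) ih s t σ lin it with iter-unsnoc k it
  ... | w , it₀ , (Qs , pa) = proj₂ (resolve k ih pa) s t σ lin it₀ refl

  below : ∀ n → Below n
  below (suc n) j (s≤s j≤n) = decomposition-step j (λ i i<j → below n i (≤-trans i<j j≤n))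

  decomposition : ∀ n → Decomposition n
  decomposition n = decomposition-step n (below n)

-- Lemma 4.2.  The decomposition of s along t gives θ with s →*_R tθ and
-- ι(xθ) ⇉ⁿ xσ; these per-variable steps combine into ⇉ⁿ_{≥Pos_V(t)}-steps
-- ι(tθ) → tσ (so n′ = n), and tθ = tσ when tσ is pure.
lemma4p2 : {F : Set} (ar : F → ℕ) (R : Sig.Rule ar → Set) →
    (∀ ρ → R ρ → Sig.UoptLL ar ρ) →
    (∀ ρ → R ρ → Sig.Deterministic ar ρ × Sig.Type3 ar ρ) →
    ((∀ ρ → R ρ → Sig.NonLV ar ρ) ⊎ (∀ ρ → R ρ → Sig.NonRV ar ρ)) →
    (s t : Sig.TermF ar) → Generic.Linear ar t →
    (σ : ℕ → Sig.TermU ar) → (∀ x → Sig.InTFU ar R (σ x)) →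
    (n : ℕ) →
    Generic.Iter (Sig.arU ar) n (Generic.Par (Sig.arU ar) (Sig.Uopt ar R))
      (Sig.ι ar s) (Generic.sub (Sig.arU ar) σ (Sig.ι ar t)) →
    Σ (ℕ → Sig.TermF ar) λ θ → Σ ℕ λ n′ → n′ ≤ n ×
      Star (Sig.CArrow ar R) s (Generic.sub ar θ t) ×
      Generic.Iter (Sig.arU ar) n′
        (Generic.ParGe (Sig.arU ar) (Generic.varPos ar t) (Sig.Uopt ar R))
        (Sig.ι ar (Generic.sub ar θ t)) (Generic.sub (Sig.arU ar) σ (Sig.ι ar t)) ×
      ((Σ (Sig.TermF ar) λ u → Sig.ι ar u ≡ Generic.sub (Sig.arU ar) σ (Sig.ι ar t)) →
        Sig.ι ar (Generic.sub ar θ t) ≡ Generic.sub (Sig.arU ar) σ (Sig.ι ar t))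
lemma4p2 ar R ull dt _ s t lin σ _ n steps with LastStep.decomposition ar R ull dt n s t σ lin steps
... | θ , s⟶*tθ , tracks =
  θ , n , ≤-refl , s⟶*tθ , below-var-positions , ι-sub-pure θ σ t (λ x m → proj₂ (tracks x m))
  where
  open Sig ar
  open Embedding ar
  below-var-positions : H.Iter n (H.ParGe (G.varPos t) (Uopt R)) (ι (G.sub θ t)) (H.sub σ (ι t))
  below-var-positions = subst (λ u → H.Iter n (H.ParGe (G.varPos t) (Uopt R)) u (H.sub σ (ι t))) (sym (ι-sub θ t))
                          (iter-sub-below n t (λ x m → proj₁ (tracks x m)))
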